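{- If $G_1$ and $G_2$ are triangle graphs, then their disjoint union $G_1+G_2$ and their join $G_1*G_2$ are also triangle graphs.
   Context: A graph $G$ is triangle if for every maximal stable set $S$ of $G$ and every edge $uv$ of $G$ with $u,v\notin S$ there is a vertex $s\in S$ such that $\{u,v,s\}$ induces a triangle. The disjoint union $G_1+G_2$ of vertex-disjoint graphs has vertex set $V(G_1)\cup V(G_2)$ and edge set $E(G_1)\cup E(G_2)$; the join $G_1*G_2$ additionally contains all edges $x_1x_2$ with $x_1\in V(G_1)$, $x_2\in V(G_2)$. -}

module Defs where

open import Data.Nat using (ℕ; _+_)
open import Data.Fin using (Fin; splitAt)
open import Data.Bool using (Bool; true; false; T)
open import Data.Sum using (_⊎_; inj₁; inj₂)
open import Data.Product using (_×_; Σ; ∃-syntax)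
open import Relation.Nullary using (¬_)
open import Relation.Binary.PropositionalEquality using (_≡_)

record Graph (n : ℕ) : Set where
  field
    adj   : Fin n → Fin n → Bool
    sym   : ∀ u v → adj u v ≡ adj v u
    irrefl : ∀ v → adj v v ≡ false
open Graph public

Edge : ∀ {n} → Graph n → Fin n → Fin n → Set
Edge G u v = T (adj G u v)

VSet : ℕ → Set
VSet n = Fin n → Bool

_∈S_ : ∀ {n} → Fin n → VSet n → Set
v ∈S S = T (S v)

_⊆S_ : ∀ {n} → VSet n → VSet n → Set
S ⊆S T' = ∀ v → v ∈S S → v ∈S T'

Stable : ∀ {n} → Graph n → VSet n → Set
Stable G S = ∀ u v → u ∈S S → v ∈S S → ¬ Edge G u v

MaximalStable : ∀ {n} → Graph n → VSet n → Set
MaximalStable G S =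
  Stable G S × (∀ S' → Stable G S' → S ⊆S S' → S' ⊆S S)

IsTriangle : ∀ {n} → Graph n → Set
IsTriangle G =
  ∀ S → MaximalStable G S →
  ∀ u v → Edge G u v → ¬ (u ∈S S) → ¬ (v ∈S S) →
  ∃[ s ] (s ∈S S × Edge G u s × Edge G v s)

-- Disjoint union and join on Fin (n₁ + n₂): first n₁ vertices are G₁'s.
private
  unionAdj : ∀ {n₁ n₂} → Graph n₁ → Graph n₂ → Bool →
             Fin (n₁ + n₂) → Fin (n₁ + n₂) → Bool
  unionAdj {n₁} G₁ G₂ cross u v with splitAt n₁ u | splitAt n₁ v
  ... | inj₁ a | inj₁ b = adj G₁ a b
  ... | inj₂ a | inj₂ b = adj G₂ a b
  ... | inj₁ _ | inj₂ _ = cross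
  ... | inj₂ _ | inj₁ _ = cross

  unionSym : ∀ {n₁ n₂} (G₁ : Graph n₁) (G₂ : Graph n₂) c u v →
             unionAdj G₁ G₂ c u v ≡ unionAdj G₁ G₂ c v u
  unionSym {n₁} G₁ G₂ c u v with splitAt n₁ u | splitAt n₁ v
  ... | inj₁ a | inj₁ b = sym G₁ a b
  ... | inj₂ a | inj₂ b = sym G₂ a b
  ... | inj₁ _ | inj₂ _ = Relation.Binary.PropositionalEquality.refl
  ... | inj₂ _ | inj₁ _ = Relation.Binary.PropositionalEquality.refl

  unionIrr : ∀ {n₁ n₂} (G₁ : Graph n₁) (G₂ : Graph n₂) c v →
             unionAdj G₁ G₂ c v v ≡ false
  unionIrr {n₁} G₁ G₂ c v with splitAt n₁ v
  ... | inj₁ a = irrefl G₁ a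
  ... | inj₂ a = irrefl G₂ a

mkUnion : ∀ {n₁ n₂} → Graph n₁ → Graph n₂ → Bool → Graph (n₁ + n₂)
mkUnion G₁ G₂ c = record
  { adj = unionAdj G₁ G₂ c ; sym = unionSym G₁ G₂ c ; irrefl = unionIrr G₁ G₂ c }

_⊕_ : ∀ {n₁ n₂} → Graph n₁ → Graph n₂ → Graph (n₁ + n₂)
G₁ ⊕ G₂ = mkUnion G₁ G₂ false

_⊛_ : ∀ {n₁ n₂} → Graph n₁ → Graph n₂ → Graph (n₁ + n₂)
G₁ ⊛ G₂ = mkUnion G₁ G₂ true

module Submission where

-- Both G₁ + G₂ and G₁ * G₂ are graphs H whose vertex set is
-- covered by induced copies of G₁ and G₂, with a constant adjacency c between
-- the two copies (c = false for the union, c = true for the join).  We prove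
-- that every such two-part decomposition of H is a triangle graph when G₁
-- and G₂ are.  Two facts about a maximal stable set S of H drive the proof:
--   * S is dominating: every vertex outside S has a neighbour in S;
--   * the trace of S on an induced part is maximal stable in that part,
--     provided every member of S adjacent to the part lies in the part.
-- For an edge inside one part we check the proviso (for the join, a
-- neighbour of the edge in the other part already closes a triangle) and
-- apply the triangle property of that part.  For an edge across the parts
-- (join only) the neighbours in S of its two ends close a triangle by
-- domination.  Swapping the two parts of a decomposition yields one again,
-- so every case is proved once.

open import Defs
open import Data.Bool using (Bool; true; false; T; _∨_)
open import Data.Bool.Properties using (T-∨)
open import Data.Empty using (⊥-elim)
open import Data.Fin using (Fin; splitAt; _↑ˡ_; _↑ʳ_; _≟_)
open import Data.Fin.Properties using (splitAt-↑ˡ; splitAt-↑ʳ; splitAt⁻¹-↑ˡ; splitAt⁻¹-↑ʳ; any?)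
open import Data.Nat using (ℕ; _+_)
open import Data.Product using (_×_; _,_; proj₁; ∃-syntax)
open import Data.Sum using (_⊎_; inj₁; inj₂) renaming (swap to ⊎-swap)
open import Data.Unit using (tt)
open import Function using (_∘_)
open import Function.Bundles using (Equivalence)
open import Relation.Nullary using (¬_; yes; no)
open import Relation.Nullary.Decidable using (⌊_⌋; _×-dec_; toWitness; fromWitness)
open import Relation.Nullary.Decidable.Core using (T?)
open import Relation.Binary.PropositionalEquality
  using (_≡_; refl; subst; trans) renaming (sym to ≡-sym)

private
  variable
    m n n₁ n₂ : ℕ

edge-sym : (G : Graph n) {u v : Fin n} → Edge G u v → Edge G v u
edge-sym G {u} {v} = subst T (sym G u v)

no-loop : (G : Graph n) {v : Fin n} → ¬ Edge G v v
no-loop G {v} = subst T (irrefl G v)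

_∪S_ : VSet n → VSet n → VSet n
(S ∪S X) w = S w ∨ X w

∪-introˡ : {S X : VSet n} → S ⊆S (S ∪S X)
∪-introˡ {S = S} w w∈S = Equivalence.from (T-∨ {S w}) (inj₁ w∈S)

∪-introʳ : {S X : VSet n} → X ⊆S (S ∪S X)
∪-introʳ {S = S} w w∈X = Equivalence.from (T-∨ {S w}) (inj₂ w∈X)

∪-elim : {S X : VSet n} (w : Fin n) → w ∈S (S ∪S X) → w ∈S S ⊎ w ∈S X
∪-elim {S = S} w = Equivalence.to (T-∨ {S w})

single : Fin n → VSet n
single u w = ⌊ w ≟ u ⌋

single-elim : {u w : Fin n} → w ∈S single u → w ≡ u
single-elim = toWitness

image : (Fin m → Fin n) → VSet m → VSet n
image ι A w = ⌊ any? (λ a → T? (A a) ×-dec (ι a ≟ w)) ⌋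

image-intro : (ι : Fin m → Fin n) {A : VSet m} {a : Fin m} →
              a ∈S A → ι a ∈S image ι A
image-intro ι {a = a} a∈A = fromWitness (a , a∈A , refl)

image-elim : (ι : Fin m → Fin n) {A : VSet m} {w : Fin n} →
             w ∈S image ι A → ∃[ a ] (a ∈S A × ι a ≡ w)
image-elim ι = toWitness

stable-∪ : (G : Graph n) {S X : VSet n} → Stable G S → Stable G X →
           (∀ x y → x ∈S S → y ∈S X → ¬ Edge G x y) → Stable G (S ∪S X)
stable-∪ G {S} {X} stS stX apart x y x∈ y∈ e with ∪-elim {S = S} {X} x x∈ | ∪-elim {S = S} {X} y y∈
... | inj₁ x∈S | inj₁ y∈S = stS x y x∈S y∈S e
... | inj₂ x∈X | inj₂ y∈X = stX x y x∈X y∈X e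
... | inj₁ x∈S | inj₂ y∈X = apart x y x∈S y∈X e
... | inj₂ x∈X | inj₁ y∈S = apart y x y∈S x∈X (edge-sym G e)

absorb : (G : Graph n) {S : VSet n} (X : VSet n) → MaximalStable G S →
         Stable G (S ∪S X) → X ⊆S S
absorb G {S} X (_ , maximal) st w w∈X =
  maximal (S ∪S X) st (∪-introˡ {X = X}) w (∪-introʳ {S = S} {X} w w∈X)

dominate : (G : Graph n) (S : VSet n) → MaximalStable G S →
           ∀ u → ¬ u ∈S S → ∃[ s ] (s ∈S S × Edge G u s)
dominate G S M u u∉S with any? (λ s → T? (S s) ×-dec T? (adj G u s))
... | yes neighbour = neighbour
... | no lonely = ⊥-elim (u∉S (absorb G (single u) M stable u (fromWitness refl)))
  where
  singleStable : Stable G (single u)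
  singleStable x y x∈ y∈ e with single-elim x∈ | single-elim y∈
  ... | refl | refl = no-loop G e

  stable : Stable G (S ∪S single u)
  stable = stable-∪ G (proj₁ M) singleStable
    λ { x y x∈S y∈ e → lonely (x , x∈S , edge-sym G (subst (Edge G x) (single-elim y∈) e)) }

record Embedding (G : Graph m) (H : Graph n) : Set where
  field
    ι     : Fin m → Fin n
    adj-ι : ∀ a b → adj H (ι a) (ι b) ≡ adj G a b

  edge-from : ∀ {a b} → Edge H (ι a) (ι b) → Edge G a b
  edge-from {a} {b} = subst T (adj-ι a b)

  edge-to : ∀ {a b} → Edge G a b → Edge H (ι a) (ι b)
  edge-to {a} {b} = subst T (≡-sym (adj-ι a b))

open Embedding

Confined : {G : Graph m} {H : Graph n} → Embedding G H → VSet n → Set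
Confined {H = H} E S =
  ∀ w a → w ∈S S → Edge H w (ι E a) → ∃[ p ] ι E p ≡ w

-- The trace of a confined maximal stable set on a part is maximal stable:
-- a larger stable set of the part, mapped into H and added to S, stays
-- stable, so S absorbs it.
restrict : {G : Graph m} {H : Graph n} (E : Embedding G H) (S : VSet n) →
           MaximalStable H S → Confined E S → MaximalStable G (S ∘ ι E)
restrict {G = G} {H} E S M confined = traceStable , traceMaximal
  where
  traceStable : Stable G (S ∘ ι E)
  traceStable a b a∈ b∈ e = proj₁ M _ _ a∈ b∈ (edge-to E e)

  traceMaximal : ∀ S' → Stable G S' → (S ∘ ι E) ⊆S S' → S' ⊆S (S ∘ ι E)
  traceMaximal S' stS' trace⊆S' a a∈S' =
    absorb H (image (ι E) S') M stable (ι E a) (image-intro (ι E) a∈S')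
    where
    imageStable : Stable H (image (ι E) S')
    imageStable x y x∈ y∈ e with image-elim (ι E) x∈ | image-elim (ι E) y∈
    ... | p , p∈ , refl | q , q∈ , refl = stS' p q p∈ q∈ (edge-from E e)

    apart : ∀ x y → x ∈S S → y ∈S image (ι E) S' → ¬ Edge H x y
    apart x y x∈S y∈ e with image-elim (ι E) y∈
    ... | q , q∈ , refl with confined x q x∈S e
    ...   | p , refl = stS' p q (trace⊆S' p x∈S) q∈ (edge-from E e)

    stable : Stable H (S ∪S image (ι E) S')
    stable = stable-∪ H (proj₁ M) imageStable apart

Triangle : (H : Graph n) → VSet n → Fin n → Fin n → Set
Triangle H S u v = ∃[ s ] (s ∈S S × Edge H u s × Edge H v s)

triangle-in-part : {G : Graph m} {H : Graph n} (E : Embedding G H) →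
  IsTriangle G → (S : VSet n) → MaximalStable H S → Confined E S →
  ∀ {a b} → Edge G a b → ¬ ι E a ∈S S → ¬ ι E b ∈S S →
  Triangle H S (ι E a) (ι E b)
triangle-in-part E triG S M confined e a∉ b∉
  with triG (S ∘ ι E) (restrict E S M confined) _ _ e a∉ b∉
... | s , s∈ , as , bs = ι E s , s∈ , edge-to E as , edge-to E bs

record Decomposition (G₁ : Graph n₁) (G₂ : Graph n₂) (H : Graph n) (c : Bool) : Set where
  field
    part₁      : Embedding G₁ H
    part₂      : Embedding G₂ H
    adj-across : ∀ a b → adj H (ι part₁ a) (ι part₂ b) ≡ c
    cover      : ∀ w → (∃[ a ] ι part₁ a ≡ w) ⊎ (∃[ b ] ι part₂ b ≡ w)

  across : ∀ a b → T c → Edge H (ι part₁ a) (ι part₂ b)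
  across a b = subst T (≡-sym (adj-across a b))

  across-sym : ∀ a b → T c → Edge H (ι part₂ b) (ι part₁ a)
  across-sym a b = edge-sym H ∘ across a b

  no-across : ∀ {a b} → Edge H (ι part₁ a) (ι part₂ b) → T c
  no-across {a} {b} = subst T (adj-across a b)

open Decomposition

swap : {G₁ : Graph n₁} {G₂ : Graph n₂} {H : Graph n} {c : Bool} →
       Decomposition G₁ G₂ H c → Decomposition G₂ G₁ H c
swap {H = H} D = record
  { part₁      = part₂ D
  ; part₂      = part₁ D
  ; adj-across = λ b a → trans (sym H _ _) (adj-across D a b)
  ; cover      = λ w → ⊎-swap (cover D w)
  }

confined : {G₁ : Graph n₁} {G₂ : Graph n₂} {H : Graph n} {c : Bool} →
  (D : Decomposition G₁ G₂ H c) (S : VSet n) → Stable H S →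
  (T c → ∃[ p ] ι (part₁ D) p ∈S S) → Confined (part₁ D) S
confined {H = H} D S stS meets w a w∈S e with cover D w
... | inj₁ inPart₁ = inPart₁
... | inj₂ (q , refl) with no-across D (edge-sym H e)
...   | joined with meets joined
...     | p , p∈S = ⊥-elim (stS _ _ p∈S w∈S (across D p q joined))

triangle-within : {G₁ : Graph n₁} {G₂ : Graph n₂} {H : Graph n} {c : Bool} →
  IsTriangle G₁ → (D : Decomposition G₁ G₂ H c) →
  (S : VSet n) → MaximalStable H S → ∀ {a b} →
  Edge H (ι (part₁ D) a) (ι (part₁ D) b) →
  ¬ ι (part₁ D) a ∈S S → ¬ ι (part₁ D) b ∈S S →
  Triangle H S (ι (part₁ D) a) (ι (part₁ D) b)
triangle-within {c = false} triG D S M e a∉ b∉ =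
  triangle-in-part (part₁ D) triG S M (confined D S (proj₁ M) λ ())
    (edge-from (part₁ D) e) a∉ b∉
triangle-within {H = H} {c = true} triG D S M {a} {b} e a∉ b∉
  with dominate H S M _ a∉
... | s , s∈S , as with cover D s
...   | inj₂ (q , refl) = s , s∈S , as , across D b q tt
...   | inj₁ (p , refl) =
  triangle-in-part (part₁ D) triG S M (confined D S (proj₁ M) λ _ → p , s∈S)
    (edge-from (part₁ D) e) a∉ b∉

-- Edges between the parts: the neighbours in S of the two ends cannot lie
-- in opposite parts, as they would be adjacent.
triangle-across : {G₁ : Graph n₁} {G₂ : Graph n₂} {H : Graph n} {c : Bool} →
  (D : Decomposition G₁ G₂ H c) → (S : VSet n) → MaximalStable H S → ∀ {a b} →
  Edge H (ι (part₁ D) a) (ι (part₂ D) b) →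
  ¬ ι (part₁ D) a ∈S S → ¬ ι (part₂ D) b ∈S S →
  Triangle H S (ι (part₁ D) a) (ι (part₂ D) b)
triangle-across {H = H} D S M {a} {b} e a∉ b∉
  with no-across D e | dominate H S M _ a∉ | dominate H S M _ b∉
... | joined | s , s∈S , as | t , t∈S , bt with cover D s | cover D t
...   | inj₁ (p , refl) | _ = s , s∈S , as , across-sym D p b joined
...   | inj₂ _ | inj₂ (q , refl) = t , t∈S , across D a q joined , bt
...   | inj₂ (q , refl) | inj₁ (p , refl) =
  ⊥-elim (proj₁ M _ _ t∈S s∈S (across D p q joined))

decomposition-triangle : {G₁ : Graph n₁} {G₂ : Graph n₂} {H : Graph n} {c : Bool} →
  IsTriangle G₁ → IsTriangle G₂ → Decomposition G₁ G₂ H c → IsTriangle H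
decomposition-triangle tri₁ tri₂ D S M u v e u∉ v∉ with cover D u | cover D v
... | inj₁ (a , refl) | inj₁ (b , refl) = triangle-within tri₁ D S M e u∉ v∉
... | inj₂ (a , refl) | inj₂ (b , refl) = triangle-within tri₂ (swap D) S M e u∉ v∉
... | inj₁ (a , refl) | inj₂ (b , refl) = triangle-across D S M e u∉ v∉
... | inj₂ (a , refl) | inj₁ (b , refl) = triangle-across (swap D) S M e u∉ v∉

module _ (G₁ : Graph n₁) (G₂ : Graph n₂) (c : Bool) where

  private
    H : Graph (n₁ + n₂)
    H = mkUnion G₁ G₂ c

  leftPart : Embedding G₁ H
  leftPart = record { ι = _↑ˡ n₂ ; adj-ι = adj-left }
    where
    adj-left : ∀ a b → adj H (a ↑ˡ n₂) (b ↑ˡ n₂) ≡ adj G₁ a b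
    adj-left a b rewrite splitAt-↑ˡ n₁ a n₂ | splitAt-↑ˡ n₁ b n₂ = refl

  rightPart : Embedding G₂ H
  rightPart = record { ι = n₁ ↑ʳ_ ; adj-ι = adj-right }
    where
    adj-right : ∀ a b → adj H (n₁ ↑ʳ a) (n₁ ↑ʳ b) ≡ adj G₂ a b
    adj-right a b rewrite splitAt-↑ʳ n₁ n₂ a | splitAt-↑ʳ n₁ n₂ b = refl

  mkUnion-decomposition : Decomposition G₁ G₂ H c
  mkUnion-decomposition = record
    { part₁ = leftPart ; part₂ = rightPart ; adj-across = adj-across' ; cover = cover' }
    where
    adj-across' : ∀ a b → adj H (a ↑ˡ n₂) (n₁ ↑ʳ b) ≡ c
    adj-across' a b rewrite splitAt-↑ˡ n₁ a n₂ | splitAt-↑ʳ n₁ n₂ b = refl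

    cover' : ∀ w → (∃[ a ] a ↑ˡ n₂ ≡ w) ⊎ (∃[ b ] n₁ ↑ʳ b ≡ w)
    cover' w with splitAt n₁ w in eq
    ... | inj₁ a = inj₁ (a , splitAt⁻¹-↑ˡ eq)
    ... | inj₂ b = inj₂ (b , splitAt⁻¹-↑ʳ eq)

proposition5 : ∀ {n₁ n₂} (G₁ : Graph n₁) (G₂ : Graph n₂) →
    IsTriangle G₁ → IsTriangle G₂ →
    IsTriangle (G₁ ⊕ G₂) × IsTriangle (G₁ ⊛ G₂)
proposition5 G₁ G₂ tri₁ tri₂ =
    decomposition-triangle tri₁ tri₂ (mkUnion-decomposition G₁ G₂ false)
  , decomposition-triangle tri₁ tri₂ (mkUnion-decomposition G₁ G₂ true)
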